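{- Let $m \ge 1$ and let $y_s(m)$ be the number of $m$-colored chain-increasing binary trees with $s$ chains. Then $y_1(m) = 1$, and for $s > 1$, \[ y_s(m) = y_{s-1}(m) + m\, B_{s,2}\big(y_1(m), y_2(m), \dots\big), \] where $B_{s,2}$ is a partial Bell polynomial.
   Context: An $m$-colored chain-increasing binary tree with $s$ chains is a rooted, non-planar tree (children unordered) satisfying the following: - every vertex has at most $2$ children; - a vertex with exactly $2$ children is a junction; junctions are unlabeled and each is colored with one of $m$ colors, with no restriction between adjacent junctions; - a vertex with at most $1$ child is a chain; chains are uncolored and labeled bijectively by $\{1,\dots,s\}$; - along every path from the root downward, the labels of the chains encountered increase. Such trees are counted up to isomorphism preserving root, labels and colors. The partial exponential Bell polynomial is \[ B_{n,k}(x_1,x_2,\dots) = \sum \frac{n!}{\prod_i \alpha_i!} \prod_i (x_i/i!)^{\alpha_i}, \] the sum over nonnegative integer sequences with $\sum_i \alpha_i = k$ and $\sum_i i\,\alpha_i = n$. -}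

module Defs where

open import Data.Nat as ℕ using (ℕ; zero; suc; _≡ᵇ_; _!)
open import Data.Nat.Properties using (_!≢0)
open import Data.Bool using (Bool; true; false; _∧_; if_then_else_)
open import Data.Fin using (Fin)
open import Data.Unit using (⊤)
open import Data.List using (List; []; _∷_; _++_; map; concatMap; length; upTo; foldr)
open import Data.List.Relation.Unary.All using (All)
open import Data.List.Relation.Unary.Any using (Any)
open import Data.List.Relation.Unary.AllPairs using (AllPairs)
open import Data.List.Relation.Binary.Permutation.Propositional using (_↭_)
open import Data.Integer using (+_)
open import Data.Rational using (ℚ; _/_; 0ℚ; 1ℚ) renaming (_+_ to _+ℚ_; _*_ to _*ℚ_)
open import Data.Product using (Σ; _×_)
open import Relation.Nullary using (¬_)
open import Relation.Binary.PropositionalEquality using (_≡_)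

-- Concrete (planar) representatives.  A vertex with at most one child is a
-- chain (labelled by a natural number); a vertex with exactly two children
-- is a junction (unlabelled, coloured by Fin m).

data Tree (m : ℕ) : Set where
  leaf  : ℕ → Tree m
  unary : ℕ → Tree m → Tree m
  junc  : Fin m → Tree m → Tree m → Tree m

labels : ∀ {m} → Tree m → List ℕ
labels (leaf l)     = l ∷ []
labels (unary l t)  = l ∷ labels t
labels (junc c a b) = labels a ++ labels b

AllAbove : ∀ {m} → ℕ → Tree m → Set
AllAbove k t = All (λ l → k ℕ.< l) (labels t)

Increasing : ∀ {m} → Tree m → Set
Increasing (leaf l)     = ⊤
Increasing (unary l t)  = AllAbove l t × Increasing t
Increasing (junc c a b) = Increasing a × Increasing b

LabelledBy : ∀ {m} → ℕ → Tree m → Set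
LabelledBy s t = labels t ↭ map suc (upTo s)

Valid : ∀ {m} → ℕ → Tree m → Set
Valid s t = LabelledBy s t × Increasing t

data _≅_ {m : ℕ} : Tree m → Tree m → Set where
  leaf≅  : ∀ l → leaf l ≅ leaf l
  unary≅ : ∀ l {t t′} → t ≅ t′ → unary l t ≅ unary l t′
  junc≅  : ∀ c {a a′ b b′} → a ≅ a′ → b ≅ b′ → junc c a b ≅ junc c a′ b′
  swap≅  : ∀ c {a a′ b b′} → a ≅ a′ → b ≅ b′ → junc c a b ≅ junc c b′ a′

IsNumberOfTrees : (m s n : ℕ) → Set
IsNumberOfTrees m s n =
  Σ (List (Tree m)) λ L →
    length L ≡ n
    × All (Valid s) L
    × AllPairs (λ a b → ¬ (a ≅ b)) L
    × (∀ (t : Tree m) → Valid s t → Any (t ≅_) L)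

boundedSeqs : ℕ → ℕ → List (List ℕ)
boundedSeqs zero    b = [] ∷ []
boundedSeqs (suc l) b = concatMap (λ a → map (a ∷_) (boundedSeqs l b)) (upTo (suc b))

sumℕ : List ℕ → ℕ
sumℕ = foldr ℕ._+_ 0

-- Σ_i i·α_i, where the list holds α_i, α_{i+1}, … starting at index i
weighted : ℕ → List ℕ → ℕ
weighted i []       = 0
weighted i (a ∷ as) = i ℕ.* a ℕ.+ weighted (suc i) as

powℚ : ℚ → ℕ → ℚ
powℚ q zero    = 1ℚ
powℚ q (suc e) = q *ℚ powℚ q e

termProd : (ℕ → ℕ) → ℕ → List ℕ → ℚ
termProd x i []       = 1ℚ
termProd x i (a ∷ as) =
  (powℚ ((+ x i / (i !)) {{i !≢0}}) a *ℚ (+ 1 / (a !)) {{a !≢0}}) *ℚ termProd x (suc i) as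

-- B_{n,k}(x₁,x₂,…) = Σ n!/∏α_i! ∏ (x_i/i!)^{α_i}, over α with Σα_i = k, Σ iα_i = n.
-- For i > n necessarily α_i = 0 and α_i ≤ k always, so the sum ranges
-- over (α₁,…,αₙ) ∈ {0..k}ⁿ.  The sequence x is given as a function x : ℕ → ℕ
-- with x i = x_i (x 0 is unused).
bell : ℕ → ℕ → (ℕ → ℕ) → ℚ
bell n k x = foldr _+ℚ_ 0ℚ (map term (boundedSeqs n k))
  where
  term : List ℕ → ℚ
  term α = if (sumℕ α ≡ᵇ k) ∧ (weighted 1 α ≡ᵇ n)
           then (+ (n !) / 1) *ℚ termProd x 1 α
           else 0ℚ

module Submission where

-- A tree whose chains carry the sorted labels x ∷ xs is either the chain x above a tree on xs, or a
-- junction one of whose children contains x; that child is labelled by x ∷ A and the other by B for a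
-- split (A , B) of xs.  Choosing this child as the left one gives one representative per isomorphism
-- class, so y (s + 2) = y (s + 1) + m ∑_{(A,B)} y (|A| + 1) y |B|, and the sum over splits is
-- ∑_a C(s+1,a) y (a+1) y (s+1-a), which by symmetry is half of ∑_j C(s+2,j) y j y (s+2-j).
-- On the other side, a sequence α with ∑ α_i = 2 has either a single α_j = 2 or α_j = α_k = 1 with
-- j < k, so B_{n,2}(y) = ½ ∑_{j+k=n} n!/(j! k!) y j y k, the same half-sum.

open import Defs
open import Algebra.Bundles using (CommutativeSemiring; CommutativeRing)
import Algebra.Properties.CommutativeSemigroup as CommutativeSemigroupProperties
import Algebra.Solver.CommutativeMonoid as CommutativeMonoidSolver
open import Data.Bool using (Bool; true; false; _∧_; if_then_else_; T)
open import Data.Empty using (⊥-elim)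
open import Data.List using (List; []; _∷_; _++_; map; concatMap; foldr; length; upTo; allFin)
import Data.List.Properties as Listₚ
open import Data.List.Membership.Propositional using (_∈_; _∉_; find; lose)
open import Data.List.Membership.Propositional.Properties
  using (∈-++⁺ˡ; ∈-++⁺ʳ; ∈-++⁻; ∈-map⁺; ∈-map⁻; ∈-concatMap⁺; ∈-concatMap⁻; ∈-allFin; ∈-∃++)
open import Data.List.Relation.Binary.Permutation.Propositional
  using (_↭_; ↭-refl; ↭-sym; ↭-trans; ↭-prep)
open import Data.List.Relation.Binary.Permutation.Propositional.Properties
  using (∈-resp-↭; All-resp-↭; ↭-length; ↭-empty-inv; ↭-singleton-inv; drop-∷; shift; ++⁺; ++-comm)
open import Data.List.Relation.Binary.Subset.Propositional using (_⊆_)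
open import Data.List.Relation.Unary.All as All using (All; []; _∷_)
import Data.List.Relation.Unary.All.Properties as Allₚ
open import Data.List.Relation.Unary.AllPairs as AllPairs using (AllPairs; []; _∷_)
import Data.List.Relation.Unary.AllPairs.Properties as AllPairsₚ
open import Data.List.Relation.Unary.Any as Any using (Any; here; there)
import Data.List.Relation.Unary.Any.Properties as Anyₚ
open import Data.List.Relation.Unary.Unique.Propositional.Properties using (allFin⁺)
open import Data.Nat using (ℕ; zero; suc; pred; NonZero; _≤_; _<_; _≡ᵇ_; _!; s≤s; z≤n)
import Data.Nat as ℕ
import Data.Nat.Properties as ℕ
open import Data.Nat.Properties using (_!≢0; _!*_!≢0)
open import Data.Nat.Combinatorics using (_C_; nCk+nC[k+1]≡[n+1]C[k+1]; k>n⇒nCk≡0; nCk≡n!/k![n-k]!; k![n∸k]!∣n!)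
open import Data.Nat.DivMod using (m/n*n≡m)
open import Data.Product using (Σ; _×_; _,_; proj₁; proj₂; ∃; ∃₂)
open import Data.Rational using (ℚ; _/_; 0ℚ; 1ℚ; toℚᵘ) renaming (_+_ to _+ℚ_; _*_ to _*ℚ_)
import Data.Rational.Properties as ℚ
open import Data.Rational.Solver using (module +-*-Solver)
open import Data.Rational.Unnormalised as ℚᵘ using (mkℚᵘ; *≡*)
import Data.Rational.Unnormalised.Properties as ℚᵘ
open import Data.Sum using (inj₁; inj₂)
open import Function using (id; _∘_; flip)
open import Level using (0ℓ)
open import Relation.Nullary using (¬_)
import Relation.Binary.PropositionalEquality as ≡
import Relation.Binary.Reasoning.Setoid as SetoidReasoning

range : ℕ → ℕ → List ℕ
range i zero    = []
range i (suc l) = i ∷ range (suc i) l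

∈-range⁻ : ∀ {i l k} → k ∈ range i l → i ≤ k × k < i ℕ.+ l
∈-range⁻ {i} {suc l} (here ≡.refl) = ℕ.≤-refl , ℕ.m<m+n i (s≤s z≤n)
∈-range⁻ {i} {suc l} (there k∈)   with i<k , k<i+l ← ∈-range⁻ k∈ =
  ℕ.<⇒≤ i<k , ℕ.<-≤-trans k<i+l (ℕ.≤-reflexive (≡.sym (ℕ.+-suc i l)))

module ListSum {c ℓ} (S : CommutativeSemiring c ℓ) where

  open CommutativeSemiring S
  open CommutativeSemigroupProperties +-commutativeSemigroup using (interchange)
  open SetoidReasoning setoid
  open CommutativeMonoidSolver +-commutativeMonoid using (solve; _⊕_; _⊜_)

  ∑ : {A : Set} → List A → (A → Carrier) → Carrier
  ∑ []       f = 0#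
  ∑ (x ∷ xs) f = f x + ∑ xs f

  ∑< : {A : Set} → List A → (A → A → Carrier) → Carrier
  ∑< []       g = 0#
  ∑< (x ∷ xs) g = ∑ xs (g x) + ∑< xs g

  when : Bool → Carrier → Carrier
  when b x = if b then x else 0#

  module _ {A : Set} where

    ∑-cong : (xs : List A) {f g : A → Carrier} → (∀ {x} → x ∈ xs → f x ≈ g x) → ∑ xs f ≈ ∑ xs g
    ∑-cong []       eq = refl
    ∑-cong (x ∷ xs) eq = +-cong (eq (here ≡.refl)) (∑-cong xs (eq ∘ there))

    ∑-cong′ : (xs : List A) {f g : A → Carrier} → (∀ x → f x ≈ g x) → ∑ xs f ≈ ∑ xs g
    ∑-cong′ xs eq = ∑-cong xs (λ {x} _ → eq x)

    ∑-++ : (xs ys : List A) (f : A → Carrier) → ∑ (xs ++ ys) f ≈ ∑ xs f + ∑ ys f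
    ∑-++ []       ys f = sym (+-identityˡ _)
    ∑-++ (x ∷ xs) ys f = trans (+-congˡ (∑-++ xs ys f)) (sym (+-assoc _ _ _))

    ∑-+ : (xs : List A) (f g : A → Carrier) → ∑ xs (λ x → f x + g x) ≈ ∑ xs f + ∑ xs g
    ∑-+ []       f g = sym (+-identityˡ 0#)
    ∑-+ (x ∷ xs) f g = trans (+-congˡ (∑-+ xs f g)) (interchange _ _ _ _)

    ∑-*ˡ : (xs : List A) (a : Carrier) (f : A → Carrier) → ∑ xs (λ x → a * f x) ≈ a * ∑ xs f
    ∑-*ˡ []       a f = sym (zeroʳ a)
    ∑-*ˡ (x ∷ xs) a f = trans (+-congˡ (∑-*ˡ xs a f)) (sym (distribˡ a _ _))

    ∑-0 : (xs : List A) → ∑ xs (λ _ → 0#) ≈ 0#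
    ∑-0 []       = refl
    ∑-0 (x ∷ xs) = trans (+-identityˡ _) (∑-0 xs)

    ∑-map : {B : Set} (g : B → A) (xs : List B) (f : A → Carrier) → ∑ (map g xs) f ≈ ∑ xs (f ∘ g)
    ∑-map g []       f = refl
    ∑-map g (x ∷ xs) f = +-congˡ (∑-map g xs f)

    ∑-concatMap : {B : Set} (g : B → List A) (xs : List B) (f : A → Carrier) →
                  ∑ (concatMap g xs) f ≈ ∑ xs (λ x → ∑ (g x) f)
    ∑-concatMap g []       f = refl
    ∑-concatMap g (x ∷ xs) f = trans (∑-++ (g x) _ f) (+-congˡ (∑-concatMap g xs f))

    ∑-as-foldr : (xs : List A) (f : A → Carrier) → foldr _+_ 0# (map f xs) ≈ ∑ xs f
    ∑-as-foldr []       f = refl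
    ∑-as-foldr (x ∷ xs) f = +-congˡ (∑-as-foldr xs f)

    ∑∑-symmetric : (xs : List A) (g : A → A → Carrier) → (∀ x y → g x y ≈ g y x) →
                   ∑ xs (λ x → ∑ xs (g x)) ≈ (∑< xs g + ∑< xs g) + ∑ xs (λ x → g x x)
    ∑∑-symmetric []       g sym-g = sym (trans (+-identityʳ _) (+-identityʳ 0#))
    ∑∑-symmetric (x ∷ xs) g sym-g = begin
      (g x x + ∑ xs (g x)) + ∑ xs (λ y → g y x + ∑ xs (g y))
        ≈⟨ +-congˡ (∑-+ xs (λ y → g y x) (λ y → ∑ xs (g y))) ⟩
      (g x x + ∑ xs (g x)) + (∑ xs (λ y → g y x) + ∑ xs (λ y → ∑ xs (g y)))
        ≈⟨ +-congˡ (+-cong (∑-cong′ xs (λ y → sym-g y x)) (∑∑-symmetric xs g sym-g)) ⟩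
      (g x x + r) + (r + ((d + d) + δ))
        ≈⟨ solve 4 (λ a r d δ → (a ⊕ r) ⊕ (r ⊕ ((d ⊕ d) ⊕ δ)) ⊜ ((r ⊕ d) ⊕ (r ⊕ d)) ⊕ (a ⊕ δ)) refl (g x x) r d δ ⟩
      ((r + d) + (r + d)) + (g x x + δ) ∎
      where
      r = ∑ xs (g x)
      d = ∑< xs g
      δ = ∑ xs (λ y → g y y)

  ∑-range-suc : ∀ i l (f : ℕ → Carrier) → ∑ (range (suc i) l) f ≈ ∑ (range i l) (f ∘ suc)
  ∑-range-suc i zero    f = refl
  ∑-range-suc i (suc l) f = +-congˡ (∑-range-suc (suc i) l f)

  *-when : ∀ b x y → x * when b y ≈ when b (x * y)
  *-when true  x y = refl
  *-when false x y = zeroʳ x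

  when-+ : ∀ b x y → when b x + when b y ≈ when b (x + y)
  when-+ true  x y = refl
  when-+ false x y = +-identityˡ 0#

  when-true : ∀ {b} x → T b → when b x ≈ x
  when-true {true} x _ = refl

  when-false : ∀ {b} x → ¬ T b → when b x ≈ 0#
  when-false {true}  x ¬b = ⊥-elim (¬b _)
  when-false {false} x ¬b = refl

  ∑-range-when-below : ∀ i l c (p : ℕ → Bool) (φ : ℕ → Carrier) → (∀ k → T (p k) → k ≡.≡ c) → c < i →
                       ∑ (range i l) (λ k → when (p k) (φ k)) ≈ 0#
  ∑-range-when-below i zero    c p φ p⇒≡c c<i = refl
  ∑-range-when-below i (suc l) c p φ p⇒≡c c<i = trans
    (+-cong (when-false (φ i) λ pi → ℕ.<-irrefl (≡.sym (p⇒≡c i pi)) c<i)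
            (∑-range-when-below (suc i) l c p φ p⇒≡c (ℕ.m<n⇒m<1+n c<i)))
    (+-identityˡ 0#)

  ∑-range-when-unique : ∀ i l c (p : ℕ → Bool) (φ : ℕ → Carrier) → (∀ k → T (p k) → k ≡.≡ c) → T (p c) →
                        i ≤ c → c < i ℕ.+ l → ∑ (range i l) (λ k → when (p k) (φ k)) ≈ φ c
  ∑-range-when-unique i zero c p φ p⇒≡c pc i≤c c<i+0 =
    ⊥-elim (ℕ.<-irrefl ≡.refl (ℕ.<-≤-trans c<i+0 (ℕ.≤-trans (ℕ.≤-reflexive (ℕ.+-identityʳ i)) i≤c)))
  ∑-range-when-unique i (suc l) c p φ p⇒≡c pc i≤c c<i+l with ℕ.m≤n⇒m<n∨m≡n i≤c
  ... | inj₂ ≡.refl = trans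
    (+-cong (when-true (φ i) pc) (∑-range-when-below (suc i) l i p φ p⇒≡c (ℕ.n<1+n i)))
    (+-identityʳ (φ i))
  ... | inj₁ i<c = trans
    (+-cong (when-false (φ i) λ pi → ℕ.<-irrefl (p⇒≡c i pi) i<c)
            (∑-range-when-unique (suc i) l c p φ p⇒≡c pc i<c (ℕ.<-≤-trans c<i+l (ℕ.≤-reflexive (ℕ.+-suc i l)))))
    (+-identityˡ (φ c))

open import Data.Nat using (_+_; _*_; _∸_)
open import Relation.Binary.PropositionalEquality using (_≡_; refl; sym; trans; cong; cong₂; module ≡-Reasoning)

module ℕ∑ = ListSum ℕ.+-*-commutativeSemiring

AllPairs-map∈ : ∀ {A : Set} {R S : A → A → Set} {xs} →
                (∀ {a b} → a ∈ xs → b ∈ xs → R a b → S a b) → AllPairs R xs → AllPairs S xs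
AllPairs-map∈ f []           = []
AllPairs-map∈ f (rx ∷ rxs) =
  All.tabulate (λ b∈ → f (here refl) (there b∈) (All.lookup rx b∈))
  ∷ AllPairs-map∈ (λ a∈ b∈ → f (there a∈) (there b∈)) rxs

AllPairs-concatMap⁺ : ∀ {A B : Set} {R : B → B → Set} (f : A → List B) {xs} →
                      All (λ x → AllPairs R (f x)) xs →
                      AllPairs (λ x y → ∀ {u v} → u ∈ f x → v ∈ f y → R u v) xs →
                      AllPairs R (concatMap f xs)
AllPairs-concatMap⁺ f within across = AllPairsₚ.concat⁺ (Allₚ.map⁺ within)
  (AllPairsₚ.map⁺ (AllPairs.map (λ r → All.tabulate λ u∈ → All.tabulate λ v∈ → r u∈ v∈) across))

∈-↭-∷ : ∀ {A : Set} {x : A} {xs} → x ∈ xs → ∃ λ ys → xs ↭ x ∷ ys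
∈-↭-∷ {x = x} x∈xs with ys , zs , refl ← ∈-∃++ x∈xs = ys ++ zs , shift x ys zs

Sorted : List ℕ → Set
Sorted = AllPairs _<_

insertEither : ℕ → List ℕ × List ℕ → List (List ℕ × List ℕ)
insertEither x (A , B) = (x ∷ A , B) ∷ (A , x ∷ B) ∷ []

splits : List ℕ → List (List ℕ × List ℕ)
splits []       = ([] , []) ∷ []
splits (x ∷ xs) = concatMap (insertEither x) (splits xs)

data SplitsStep (x : ℕ) (xs : List ℕ) : List ℕ × List ℕ → Set where
  left  : ∀ {A B} → (A , B) ∈ splits xs → SplitsStep x xs (x ∷ A , B)
  right : ∀ {A B} → (A , B) ∈ splits xs → SplitsStep x xs (A , x ∷ B)

∈-splits-∷⁻ : ∀ {x xs p} → p ∈ splits (x ∷ xs) → SplitsStep x xs p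
∈-splits-∷⁻ {x} {xs} p∈ with find (∈-concatMap⁻ (insertEither x) {splits xs} p∈)
... | _ , q∈ , here refl         = left q∈
... | _ , q∈ , there (here refl) = right q∈

∈-splits-∷⁺ˡ : ∀ {x xs A B} → (A , B) ∈ splits xs → (x ∷ A , B) ∈ splits (x ∷ xs)
∈-splits-∷⁺ˡ q∈ = ∈-concatMap⁺ (insertEither _) (lose q∈ (here refl))

∈-splits-∷⁺ʳ : ∀ {x xs A B} → (A , B) ∈ splits xs → (A , x ∷ B) ∈ splits (x ∷ xs)
∈-splits-∷⁺ʳ q∈ = ∈-concatMap⁺ (insertEither _) (lose q∈ (there (here refl)))

splits-↭ : ∀ xs {A B} → (A , B) ∈ splits xs → A ++ B ↭ xs
splits-↭ []       (here refl) = ↭-refl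
splits-↭ (x ∷ xs) p∈ with ∈-splits-∷⁻ {x} {xs} p∈
... | left          q∈ = ↭-prep x (splits-↭ xs q∈)
... | right {A} {B} q∈ = ↭-trans (shift x A B) (↭-prep x (splits-↭ xs q∈))

splits-⊆ˡ : ∀ xs {A B} → (A , B) ∈ splits xs → A ⊆ xs
splits-⊆ˡ xs p∈ z∈ = ∈-resp-↭ (splits-↭ xs p∈) (∈-++⁺ˡ z∈)

splits-⊆ʳ : ∀ xs {A B} → (A , B) ∈ splits xs → B ⊆ xs
splits-⊆ʳ xs {A} p∈ z∈ = ∈-resp-↭ (splits-↭ xs p∈) (∈-++⁺ʳ A z∈)

splits-sorted : ∀ xs {A B} → Sorted xs → (A , B) ∈ splits xs → Sorted A × Sorted B
splits-sorted []       _              (here refl) = [] , []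
splits-sorted (x ∷ xs) (x<xs ∷ sorted) p∈ with ∈-splits-∷⁻ {x} {xs} p∈
... | left  q∈ = let A-sorted , B-sorted = splits-sorted xs sorted q∈ in
                 Allₚ.anti-mono (splits-⊆ˡ xs q∈) x<xs ∷ A-sorted , B-sorted
... | right q∈ = let A-sorted , B-sorted = splits-sorted xs sorted q∈ in
                 A-sorted , Allₚ.anti-mono (splits-⊆ʳ xs q∈) x<xs ∷ B-sorted

splits-sorted-∷ : ∀ {x xs A B} → Sorted (x ∷ xs) → (A , B) ∈ splits xs → Sorted (x ∷ A) × Sorted B
splits-sorted-∷ {xs = xs} (x<xs ∷ sorted) p∈ =
  Allₚ.anti-mono (splits-⊆ˡ xs p∈) x<xs ∷ proj₁ (splits-sorted xs sorted p∈) , proj₂ (splits-sorted xs sorted p∈)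

splits-complete : ∀ xs P Q → P ++ Q ↭ xs → ∃₂ λ A B → (A , B) ∈ splits xs × P ↭ A × Q ↭ B
splits-complete []       P  Q  PQ↭[] with ↭-empty-inv PQ↭[]
splits-complete []       [] [] _ | refl = [] , [] , here refl , ↭-refl , ↭-refl
splits-complete (x ∷ xs) P  Q  PQ↭ with ∈-++⁻ P (∈-resp-↭ (↭-sym PQ↭) (here refl))
... | inj₁ x∈P with P′ , P↭ ← ∈-↭-∷ x∈P
                 with A , B , q∈ , P′↭A , Q↭B ← splits-complete xs P′ Q (drop-∷ (↭-trans (↭-sym (++⁺ P↭ ↭-refl)) PQ↭))
  = x ∷ A , B , ∈-splits-∷⁺ˡ {x} {xs} q∈ , ↭-trans P↭ (↭-prep x P′↭A) , Q↭B
... | inj₂ x∈Q with Q′ , Q↭ ← ∈-↭-∷ x∈Q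
                 with A , B , q∈ , P↭A , Q′↭B ← splits-complete xs P Q′
                        (drop-∷ (↭-trans (↭-sym (shift x P Q′)) (↭-trans (↭-sym (++⁺ {x = P} ↭-refl Q↭)) PQ↭)))
  = A , x ∷ B , ∈-splits-∷⁺ʳ {x} {xs} q∈ , P↭A , ↭-trans Q↭ (↭-prep x Q′↭B)

splits-distinct : ∀ xs → Sorted xs → AllPairs (λ p q → ¬ (proj₁ p ↭ proj₁ q)) (splits xs)
splits-distinct []       _               = [] ∷ []
splits-distinct (x ∷ xs) (x<xs ∷ sorted) =
  AllPairs-concatMap⁺ (insertEither x)
    (All.tabulate λ _ → ((λ x∷A↭A → ℕ.1+n≢n (↭-length x∷A↭A)) ∷ []) ∷ [] ∷ [])
    (AllPairs-map∈ across (splits-distinct xs sorted))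
  where
  x∉ : ∀ {A B} → (A , B) ∈ splits xs → x ∉ A
  x∉ q∈ x∈A = ℕ.<-irrefl refl (All.lookup x<xs (splits-⊆ˡ xs q∈ x∈A))
  across : ∀ {p q} → p ∈ splits xs → q ∈ splits xs → ¬ (proj₁ p ↭ proj₁ q) →
           ∀ {u v} → u ∈ insertEither x p → v ∈ insertEither x q → ¬ (proj₁ u ↭ proj₁ v)
  across p∈ q∈ A≁A′ (here refl)         (here refl)         u↭v = A≁A′ (drop-∷ u↭v)
  across p∈ q∈ A≁A′ (here refl)         (there (here refl)) u↭v = x∉ q∈ (∈-resp-↭ u↭v (here refl))
  across p∈ q∈ A≁A′ (there (here refl)) (here refl)         u↭v = x∉ p∈ (∈-resp-↭ (↭-sym u↭v) (here refl))
  across p∈ q∈ A≁A′ (there (here refl)) (there (here refl)) u↭v = A≁A′ u↭v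

module _ where

  open ℕ∑
  open CommutativeSemigroupProperties ℕ.+-commutativeSemigroup using () renaming (x∙yz≈y∙xz to +-x∙yz≈y∙xz)

  subsetSum : ℕ → (ℕ → ℕ → ℕ) → ℕ
  subsetSum zero    h = h 0 0
  subsetSum (suc s) h = subsetSum s (λ a b → h (suc a) b) + subsetSum s (λ a b → h a (suc b))

  subsetSum-cong : ∀ s {h h′ : ℕ → ℕ → ℕ} → (∀ a b → a + b ≡ s → h a b ≡ h′ a b) →
                   subsetSum s h ≡ subsetSum s h′
  subsetSum-cong zero    eq = eq 0 0 refl
  subsetSum-cong (suc s) eq = cong₂ _+_
    (subsetSum-cong s λ a b a+b≡s → eq (suc a) b (cong suc a+b≡s))
    (subsetSum-cong s λ a b a+b≡s → eq a (suc b) (trans (ℕ.+-suc a b) (cong suc a+b≡s)))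

  subsetSum-flip : ∀ s h → subsetSum s h ≡ subsetSum s (flip h)
  subsetSum-flip zero    h = refl
  subsetSum-flip (suc s) h = trans
    (cong₂ _+_ (subsetSum-flip s (λ a b → h (suc a) b)) (subsetSum-flip s (λ a b → h a (suc b))))
    (ℕ.+-comm (subsetSum s (λ a b → h (suc b) a)) (subsetSum s (λ a b → h b (suc a))))

  binomialSum : ℕ → (ℕ → ℕ → ℕ) → ℕ
  binomialSum s h = ∑ (range 0 (suc s)) λ a → (s C a) * h a (s ∸ a)

  C-∸-suc : ∀ s k (f : ℕ → ℕ) → (s C k) * f (suc (s ∸ k)) ≡ (s C k) * f (suc s ∸ k)
  C-∸-suc s k f with ℕ.≤-<-connex k s
  ... | inj₁ k≤s = cong (λ z → (s C k) * f z) (sym (ℕ.+-∸-assoc 1 k≤s))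
  ... | inj₂ s<k rewrite k>n⇒nCk≡0 s<k = refl

  -- Padding the range is what lets the induction go through without peeling off the last term.
  subsetSum-binomial-padded : ∀ s N h → s ≤ N → subsetSum s h ≡ ∑ (range 0 (suc N)) λ a → (s C a) * h a (s ∸ a)
  subsetSum-binomial-padded zero N h _ = sym (begin
    ∑ (range 0 (suc N)) (λ a → (0 C a) * h a (0 ∸ a)) ≡⟨ cong₂ _+_ (ℕ.*-identityˡ _) (∑-range-suc 0 N _) ⟩
    h 0 0 + ∑ (range 0 N) (λ _ → 0)                 ≡⟨ cong (h 0 0 +_) (∑-0 (range 0 N)) ⟩
    h 0 0 + 0                                       ≡⟨ ℕ.+-identityʳ _ ⟩
    h 0 0                                           ∎)
    where open ≡-Reasoning
  subsetSum-binomial-padded (suc s) (suc N) h (s≤s s≤N) = sym (begin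
    ∑ (range 0 (suc (suc N))) (λ a → (suc s C a) * h a (suc s ∸ a))
      ≡⟨ cong₂ _+_ (ℕ.*-identityˡ h₀) (∑-range-suc 0 (suc N) λ a → (suc s C a) * h a (suc s ∸ a)) ⟩
    h₀ + ∑ (range 0 (suc N)) (λ a → (suc s C suc a) * h (suc a) (s ∸ a))
      ≡⟨ cong (h₀ +_) (∑-cong′ (range 0 (suc N)) λ a →
           trans (cong (_* h (suc a) (s ∸ a)) (sym (nCk+nC[k+1]≡[n+1]C[k+1] s a)))
                 (ℕ.*-distribʳ-+ (h (suc a) (s ∸ a)) (s C a) (s C suc a))) ⟩
    h₀ + ∑ (range 0 (suc N)) (λ a → (s C a) * h (suc a) (s ∸ a) + (s C suc a) * h (suc a) (s ∸ a))
      ≡⟨ cong (h₀ +_) (∑-+ (range 0 (suc N)) (λ a → (s C a) * h (suc a) (s ∸ a)) (λ a → (s C suc a) * h (suc a) (s ∸ a))) ⟩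
    h₀ + (∑ (range 0 (suc N)) (λ a → (s C a) * h (suc a) (s ∸ a)) + R)
      ≡⟨ +-x∙yz≈y∙xz h₀ L R ⟩
    L + (h₀ + R)
      ≡⟨ cong₂ _+_ (sym (subsetSum-binomial-padded s N (λ a b → h (suc a) b) s≤N)) (sym second-sum) ⟩
    subsetSum s (λ a b → h (suc a) b) + subsetSum s (λ a b → h a (suc b)) ∎)
    where
    open ≡-Reasoning
    h₀ = h 0 (suc s)
    L = ∑ (range 0 (suc N)) (λ a → (s C a) * h (suc a) (s ∸ a))
    R = ∑ (range 0 (suc N)) (λ a → (s C suc a) * h (suc a) (s ∸ a))
    second-sum : subsetSum s (λ a b → h a (suc b)) ≡ h₀ + R
    second-sum = begin
      subsetSum s (λ a b → h a (suc b))
        ≡⟨ subsetSum-binomial-padded s (suc N) (λ a b → h a (suc b)) (ℕ.m≤n⇒m≤1+n s≤N) ⟩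
      ∑ (range 0 (suc (suc N))) (λ a → (s C a) * h a (suc (s ∸ a)))
        ≡⟨ cong₂ _+_ (ℕ.*-identityˡ h₀) (∑-range-suc 0 (suc N) λ a → (s C a) * h a (suc (s ∸ a))) ⟩
      h₀ + ∑ (range 0 (suc N)) (λ a → (s C suc a) * h (suc a) (suc (s ∸ suc a)))
        ≡⟨ cong (h₀ +_) (∑-cong′ (range 0 (suc N)) λ a → C-∸-suc s (suc a) (h (suc a))) ⟩
      h₀ + R ∎

  subsetSum-binomial : ∀ s h → subsetSum s h ≡ binomialSum s h
  subsetSum-binomial s h = subsetSum-binomial-padded s s h ℕ.≤-refl

  subsetSum-suc-symmetric : ∀ s (g : ℕ → ℕ → ℕ) → (∀ a b → g a b ≡ g b a) →
                            subsetSum (suc s) g ≡ subsetSum s (λ a b → g (suc a) b) + subsetSum s (λ a b → g (suc a) b)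
  subsetSum-suc-symmetric s g sym-g = cong (subsetSum s (λ a b → g (suc a) b) +_)
    (trans (subsetSum-flip s (λ a b → g a (suc b))) (subsetSum-cong s λ a b _ → sym-g b (suc a)))

  ∑-splits : ∀ xs (h : ℕ → ℕ → ℕ) → ∑ (splits xs) (λ (A , B) → h (length A) (length B)) ≡ subsetSum (length xs) h
  ∑-splits []       h = ℕ.+-identityʳ (h 0 0)
  ∑-splits (x ∷ xs) h = begin
    ∑ (concatMap (insertEither x) (splits xs)) H
      ≡⟨ ∑-concatMap (insertEither x) (splits xs) H ⟩
    ∑ (splits xs) (λ (A , B) → h (suc (length A)) (length B) + (h (length A) (suc (length B)) + 0))
      ≡⟨ ∑-cong′ (splits xs) (λ (A , B) → cong (h (suc (length A)) (length B) +_) (ℕ.+-identityʳ _)) ⟩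
    ∑ (splits xs) (λ (A , B) → h (suc (length A)) (length B) + h (length A) (suc (length B)))
      ≡⟨ ∑-+ (splits xs) (λ (A , B) → h (suc (length A)) (length B)) (λ (A , B) → h (length A) (suc (length B))) ⟩
    ∑ (splits xs) (λ (A , B) → h (suc (length A)) (length B)) + ∑ (splits xs) (λ (A , B) → h (length A) (suc (length B)))
      ≡⟨ cong₂ _+_ (∑-splits xs λ a b → h (suc a) b) (∑-splits xs λ a b → h a (suc b)) ⟩
    subsetSum (suc (length xs)) h ∎
    where
    open ≡-Reasoning
    H = λ (p : List ℕ × List ℕ) → h (length (proj₁ p)) (length (proj₂ p))

  length-concatMap : ∀ {A B : Set} (f : A → List B) xs → length (concatMap f xs) ≡ ∑ xs (λ x → length (f x))
  length-concatMap f []       = refl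
  length-concatMap f (x ∷ xs) = trans (Listₚ.length-++ (f x)) (cong (length (f x) +_) (length-concatMap f xs))

  ∑-const : ∀ {A : Set} (xs : List A) k → ∑ xs (λ _ → k) ≡ length xs * k
  ∑-const []       k = refl
  ∑-const (x ∷ xs) k = cong (k +_) (∑-const xs k)

sorted-1…s : ∀ s → Sorted (map suc (upTo s))
sorted-1…s s = AllPairsₚ.map⁺ (AllPairs.map s≤s (AllPairsₚ.applyUpTo⁺₁ id s (λ i<j _ → i<j)))

length-1…s : ∀ s → length (map suc (upTo s)) ≡ s
length-1…s s = trans (Listₚ.length-map suc (upTo s)) (Listₚ.length-upTo s)

module _ {m : ℕ} where

  labels-nonempty : (t : Tree m) → 1 ≤ length (labels t)
  labels-nonempty (leaf l)     = s≤s z≤n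
  labels-nonempty (unary l t)  = s≤s z≤n
  labels-nonempty (junc c a b) = ℕ.≤-trans (labels-nonempty a)
    (ℕ.≤-trans (ℕ.m≤m+n _ _) (ℕ.≤-reflexive (sym (Listₚ.length-++ (labels a)))))

  ≅-labels : {t t′ : Tree m} → t ≅ t′ → labels t ↭ labels t′
  ≅-labels (leaf≅ l)        = ↭-refl
  ≅-labels (unary≅ l t≅t′)  = ↭-prep l (≅-labels t≅t′)
  ≅-labels (junc≅ c a≅ b≅)  = ++⁺ (≅-labels a≅) (≅-labels b≅)
  ≅-labels (swap≅ c {a′ = a′} {b′ = b′} a≅ b≅) =
    ↭-trans (++⁺ (≅-labels a≅) (≅-labels b≅)) (++-comm (labels a′) (labels b′))

  junc-≅⁻ : ∀ {x c c′} {a b a′ b′ : Tree m} → x ∈ labels a → x ∉ labels b′ →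
            junc c a b ≅ junc c′ a′ b′ → c ≡ c′ × a ≅ a′ × b ≅ b′
  junc-≅⁻ x∈a x∉b′ (junc≅ c a≅ b≅) = refl , a≅ , b≅
  junc-≅⁻ x∈a x∉b′ (swap≅ c a≅ b≅) = ⊥-elim (x∉b′ (∈-resp-↭ (≅-labels a≅) x∈a))

  junc-≅-colour : ∀ {c c′} {a b a′ b′ : Tree m} → junc c a b ≅ junc c′ a′ b′ → c ≡ c′
  junc-≅-colour (junc≅ c _ _) = refl
  junc-≅-colour (swap≅ c _ _) = refl

module Enumeration (m : ℕ) where

  open ℕ∑

  _≇_ : Tree m → Tree m → Set
  t ≇ t′ = ¬ t ≅ t′

  colourings : Tree m → Tree m → List (Tree m)
  colourings a b = map (λ c → junc c a b) (allFin m)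

  junctions : List (Tree m) → List (Tree m) → List (Tree m)
  junctions as bs = concatMap (λ a → concatMap (colourings a) bs) as

  data IsJunction (as bs : List (Tree m)) : Tree m → Set where
    junction : ∀ {a b} c → a ∈ as → b ∈ bs → IsJunction as bs (junc c a b)

  ∈-junctions⁻ : ∀ as bs {t} → t ∈ junctions as bs → IsJunction as bs t
  ∈-junctions⁻ as bs t∈ with a , a∈ , t∈′ ← find (∈-concatMap⁻ _ {as} t∈)
                         with b , b∈ , t∈″ ← find (∈-concatMap⁻ _ {bs} t∈′)
                         with c , _ , refl ← ∈-map⁻ (λ c → junc c a b) t∈″
    = junction c a∈ b∈

  ∈-junctions⁺ : ∀ {as bs a b} c → a ∈ as → b ∈ bs → junc c a b ∈ junctions as bs
  ∈-junctions⁺ c a∈ b∈ =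
    ∈-concatMap⁺ _ (lose a∈ (∈-concatMap⁺ _ (lose b∈ (∈-map⁺ (λ c → junc c _ _) (∈-allFin c)))))

  length-junctions : ∀ as bs → length (junctions as bs) ≡ length as * (length bs * m)
  length-junctions as bs = begin
    length (junctions as bs)
      ≡⟨ length-concatMap _ as ⟩
    ∑ as (λ a → length (concatMap (colourings a) bs))
      ≡⟨ ∑-cong′ as (λ a → trans (length-concatMap _ bs) (∑-cong′ bs λ b →
           trans (Listₚ.length-map (λ c → junc c a b) (allFin m)) (Listₚ.length-tabulate id))) ⟩
    ∑ as (λ _ → ∑ bs (λ _ → m))
      ≡⟨ ∑-cong′ as (λ _ → ∑-const bs m) ⟩
    ∑ as (λ _ → length bs * m)
      ≡⟨ ∑-const as _ ⟩
    length as * (length bs * m) ∎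
    where open ≡-Reasoning

  junctions-distinct : ∀ {x as bs} → (∀ {a} → a ∈ as → x ∈ labels a) → (∀ {b} → b ∈ bs → x ∉ labels b) →
                       AllPairs _≇_ as → AllPairs _≇_ bs → AllPairs _≇_ (junctions as bs)
  junctions-distinct {x} {as} {bs} x∈as x∉bs as-distinct bs-distinct =
    AllPairs-concatMap⁺ _ (All.tabulate within) (AllPairs-map∈ left-distinct as-distinct)
    where
    ∈-colourings⁻ : ∀ {a b u} → u ∈ colourings a b → ∃ λ c → u ≡ junc c a b
    ∈-colourings⁻ {a} {b} u∈ with c , _ , u≡ ← ∈-map⁻ (λ c → junc c a b) u∈ = c , u≡

    ∈-withLeft⁻ : ∀ {a u} → u ∈ concatMap (colourings a) bs → ∃₂ λ b c → b ∈ bs × u ≡ junc c a b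
    ∈-withLeft⁻ u∈ with b , b∈ , u∈′ ← find (∈-concatMap⁻ _ {bs} u∈)
                   with c , u≡ ← ∈-colourings⁻ u∈′ = b , c , b∈ , u≡

    colours-distinct : ∀ {a b} → AllPairs _≇_ (colourings a b)
    colours-distinct = AllPairsₚ.map⁺ (AllPairs.map (λ c≢c′ u≅v → c≢c′ (junc-≅-colour u≅v)) (allFin⁺ m))

    right-distinct : ∀ {a b b′} → a ∈ as → b ∈ bs → b′ ∈ bs → b ≇ b′ →
                     ∀ {u v} → u ∈ colourings a b → v ∈ colourings a b′ → u ≇ v
    right-distinct a∈ _ b′∈ b≇b′ u∈ v∈ with ∈-colourings⁻ u∈ | ∈-colourings⁻ v∈
    ... | _ , refl | _ , refl = λ u≅v → b≇b′ (proj₂ (proj₂ (junc-≅⁻ (x∈as a∈) (x∉bs b′∈) u≅v)))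

    within : ∀ {a} → a ∈ as → AllPairs _≇_ (concatMap (colourings a) bs)
    within a∈ = AllPairs-concatMap⁺ _ (All.tabulate λ _ → colours-distinct) (AllPairs-map∈ (right-distinct a∈) bs-distinct)

    left-distinct : ∀ {a a′} → a ∈ as → a′ ∈ as → a ≇ a′ →
                    ∀ {u v} → u ∈ concatMap (colourings a) bs → v ∈ concatMap (colourings a′) bs → u ≇ v
    left-distinct a∈ _ a≇a′ u∈ v∈ with ∈-withLeft⁻ u∈ | ∈-withLeft⁻ v∈
    ... | _ , _ , _ , refl | _ , _ , b′∈ , refl =
      λ u≅v → a≇a′ (proj₁ (proj₂ (junc-≅⁻ (x∈as a∈) (x∉bs b′∈) u≅v)))

  -- Given fuel n ≥ length xs: one representative per isomorphism class of trees labelled by the sorted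
  -- list xs, namely the one whose root junction, if any, has the least label in its left child.
  mutual
    trees : ℕ → List ℕ → List (Tree m)
    trees zero    _                 = []
    trees (suc n) []                = []
    trees (suc n) (x ∷ [])          = leaf x ∷ []
    trees (suc n) (x ∷ xs@(_ ∷ _)) = map (unary x) (trees n xs) ++ junctionTrees n x xs

    junctionTrees : ℕ → ℕ → List ℕ → List (Tree m)
    junctionTrees n x xs = concatMap (λ (A , B) → junctions (trees n (x ∷ A)) (trees n B)) (splits xs)

  ∈-junctionTrees⁻ : ∀ n x xs {t} → t ∈ junctionTrees n x xs →
                     ∃₂ λ A B → (A , B) ∈ splits xs × IsJunction (trees n (x ∷ A)) (trees n B) t
  ∈-junctionTrees⁻ n x xs t∈ with (A , B) , p∈ , t∈′ ← find (∈-concatMap⁻ _ {splits xs} t∈) =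
    A , B , p∈ , ∈-junctions⁻ (trees n (x ∷ A)) (trees n B) t∈′

  trees-sound : ∀ n xs {t} → Sorted xs → t ∈ trees n xs → labels t ↭ xs × Increasing t
  trees-sound (suc n) (x ∷ []) _ (here refl) = ↭-refl , _
  trees-sound (suc n) (x ∷ xs@(_ ∷ _)) sorted@(x<xs ∷ xs-sorted) t∈
    with ∈-++⁻ (map (unary x) (trees n xs)) t∈
  ... | inj₁ t∈unary with u , u∈ , refl ← ∈-map⁻ (unary x) t∈unary
                     with u↭ , u-inc ← trees-sound n xs xs-sorted u∈
    = ↭-prep x u↭ , All-resp-↭ (↭-sym u↭) x<xs , u-inc
  ... | inj₂ t∈junc with A , B , p∈ , junction c a∈ b∈ ← ∈-junctionTrees⁻ n x xs t∈junc
                    with xA-sorted , B-sorted ← splits-sorted-∷ sorted p∈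
                    with a↭ , a-inc ← trees-sound n (x ∷ A) xA-sorted a∈
                       | b↭ , b-inc ← trees-sound n B B-sorted b∈
    = ↭-trans (++⁺ a↭ b↭) (↭-prep x (splits-↭ xs p∈)) , a-inc , b-inc

  module _ (n : ℕ) {x xs A B} (sorted : Sorted (x ∷ xs)) (p∈ : (A , B) ∈ splits xs) where

    min∈left : ∀ {a} → a ∈ trees n (x ∷ A) → x ∈ labels a
    min∈left a∈ = ∈-resp-↭ (↭-sym (proj₁ (trees-sound n (x ∷ A) (proj₁ (splits-sorted-∷ sorted p∈)) a∈))) (here refl)

    min∉right : ∀ {b} → b ∈ trees n B → x ∉ labels b
    min∉right b∈ x∈b = ℕ.<-irrefl refl (All.lookup (AllPairs.head sorted) (splits-⊆ʳ xs p∈ x∈B))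
      where x∈B = ∈-resp-↭ (proj₁ (trees-sound n B (proj₂ (splits-sorted-∷ sorted p∈)) b∈)) x∈b

  junctionTrees-distinct : ∀ n x xs → Sorted (x ∷ xs) → (∀ ys → Sorted ys → AllPairs _≇_ (trees n ys)) →
                           AllPairs _≇_ (junctionTrees n x xs)
  junctionTrees-distinct n x xs sorted@(_ ∷ xs-sorted) trees-distinct =
    AllPairs-concatMap⁺ _ (All.tabulate within) (AllPairs-map∈ across (splits-distinct xs xs-sorted))
    where
    within : ∀ {p} → p ∈ splits xs → AllPairs _≇_ (junctions (trees n (x ∷ proj₁ p)) (trees n (proj₂ p)))
    within {A , B} p∈ with xA-sorted , B-sorted ← splits-sorted-∷ sorted p∈ =
      junctions-distinct (min∈left n sorted p∈) (min∉right n sorted p∈)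
        (trees-distinct (x ∷ A) xA-sorted) (trees-distinct B B-sorted)

    across : ∀ {p q} → p ∈ splits xs → q ∈ splits xs → ¬ (proj₁ p ↭ proj₁ q) →
             ∀ {u v} → u ∈ junctions (trees n (x ∷ proj₁ p)) (trees n (proj₂ p)) →
                       v ∈ junctions (trees n (x ∷ proj₁ q)) (trees n (proj₂ q)) → u ≇ v
    across {A , B} {A′ , B′} p∈ q∈ A≁A′ u∈ v∈ u≅v
      with junction _ a∈ _ ← ∈-junctions⁻ (trees n (x ∷ A)) (trees n B) u∈
         | junction _ a′∈ b′∈ ← ∈-junctions⁻ (trees n (x ∷ A′)) (trees n B′) v∈
      with xA-sorted , _ ← splits-sorted-∷ sorted p∈ | xA′-sorted , _ ← splits-sorted-∷ sorted q∈ =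
      A≁A′ (drop-∷ (↭-trans (↭-sym (proj₁ (trees-sound n (x ∷ A) xA-sorted a∈)))
                   (↭-trans (≅-labels (proj₁ (proj₂ (junc-≅⁻ (min∈left n sorted p∈ a∈) (min∉right n sorted q∈ b′∈) u≅v))))
                            (proj₁ (trees-sound n (x ∷ A′) xA′-sorted a′∈)))))

  trees-distinct : ∀ n xs → Sorted xs → AllPairs _≇_ (trees n xs)
  trees-distinct zero    _                _ = []
  trees-distinct (suc n) []               _ = []
  trees-distinct (suc n) (x ∷ [])         _ = [] ∷ []
  trees-distinct (suc n) (x ∷ xs@(_ ∷ _)) sorted@(_ ∷ xs-sorted) =
    AllPairsₚ.++⁺
      (AllPairsₚ.map⁺ (AllPairs.map (λ { u≇v (unary≅ _ u≅v) → u≇v u≅v }) (trees-distinct n xs xs-sorted)))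
      (junctionTrees-distinct n x xs sorted (trees-distinct n))
      (All.tabulate λ u∈ → All.tabulate λ v∈ → unary≇junction u∈ v∈)
    where
    unary≇junction : ∀ {u v} → u ∈ map (unary x) (trees n xs) → v ∈ junctionTrees n x xs → u ≇ v
    unary≇junction u∈ v∈ with _ , _ , refl ← ∈-map⁻ (unary x) u∈
                         with _ , _ , _ , junction _ _ _ ← ∈-junctionTrees⁻ n x xs v∈ = λ ()

  ↭-sorted-head : ∀ {l x : ℕ} {L xs} → All (l <_) L → All (x <_) xs → l ∷ L ↭ x ∷ xs → l ≡ x
  ↭-sorted-head l<L x<xs lL↭xxs with ∈-resp-↭ (↭-sym lL↭xxs) (here refl) | ∈-resp-↭ lL↭xxs (here refl)
  ... | here x≡l  | _         = sym x≡l
  ... | there _   | here l≡x  = l≡x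
  ... | there x∈L | there l∈xs = ⊥-elim (ℕ.<-asym (All.lookup l<L x∈L) (All.lookup x<xs l∈xs))

  splits-length-bounds : ∀ {n xs A B} → (A , B) ∈ splits xs → length xs ≤ n → 1 ≤ length B →
                         suc (length A) ≤ n × length B ≤ n
  splits-length-bounds {n} {xs} {A} {B} p∈ xs≤n 1≤B =
      ℕ.≤-trans (ℕ.≤-trans (ℕ.≤-reflexive (ℕ.+-comm 1 (length A))) (ℕ.+-monoʳ-≤ (length A) 1≤B)) A+B≤n
    , ℕ.≤-trans (ℕ.m≤n+m (length B) (length A)) A+B≤n
    where
    A+B≤n : length A + length B ≤ n
    A+B≤n = ℕ.≤-trans (ℕ.≤-reflexive (trans (sym (Listₚ.length-++ A)) (↭-length (splits-↭ xs p∈)))) xs≤n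

  Complete : ℕ → Tree m → Set
  Complete n t = ∀ ys → Sorted ys → labels t ↭ ys → Increasing t → length ys ≤ n → Any (t ≅_) (trees n ys)

  junctionTrees-complete : ∀ n {x xs} {a b : Tree m} → Sorted (x ∷ xs) → x ∈ labels a →
                           labels a ++ labels b ↭ x ∷ xs → length xs ≤ n → Increasing a → Increasing b →
                           Complete n a → Complete n b →
                           ∃₂ λ a′ b′ → a ≅ a′ × b ≅ b′ × (∀ c → junc c a′ b′ ∈ junctionTrees n x xs)
  junctionTrees-complete n {x} {xs} {a} {b} sorted x∈a ab↭ xs≤n a-inc b-inc a-complete b-complete
    with P′ , a↭ ← ∈-↭-∷ x∈a
    with A , B , p∈ , P′↭A , b↭B ← splits-complete xs P′ (labels b) (drop-∷ (↭-trans (↭-sym (++⁺ a↭ ↭-refl)) ab↭))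
    with xA-sorted , B-sorted ← splits-sorted-∷ sorted p∈
    with A<n , B≤n ← splits-length-bounds {xs = xs} p∈ xs≤n (ℕ.≤-trans (labels-nonempty b) (ℕ.≤-reflexive (↭-length b↭B)))
    with a′ , a′∈ , a≅a′ ← find (a-complete (x ∷ A) xA-sorted (↭-trans a↭ (↭-prep x P′↭A)) a-inc A<n)
    with b′ , b′∈ , b≅b′ ← find (b-complete B B-sorted b↭B b-inc B≤n)
    = a′ , b′ , a≅a′ , b≅b′ , λ c → ∈-concatMap⁺ _ (lose p∈ (∈-junctions⁺ c a′∈ b′∈))


  junc-labels-length : ∀ c (a b : Tree m) → 2 ≤ length (labels (junc c a b))
  junc-labels-length c a b = ℕ.≤-trans (ℕ.+-mono-≤ (labels-nonempty a) (labels-nonempty b))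
                                       (ℕ.≤-reflexive (sym (Listₚ.length-++ (labels a))))

  ≅-junc : ∀ {L c} {a b : Tree m} →
           (∃₂ λ a′ b′ → a ≅ a′ × b ≅ b′ × (∀ c → junc c a′ b′ ∈ L)) → Any (junc c a b ≅_) L
  ≅-junc {c = c} (a′ , b′ , a≅a′ , b≅b′ , a′b′∈) = lose (a′b′∈ c) (junc≅ c a≅a′ b≅b′)

  ≅-junc-swapped : ∀ {L c} {a b : Tree m} →
                   (∃₂ λ b′ a′ → b ≅ b′ × a ≅ a′ × (∀ c → junc c b′ a′ ∈ L)) → Any (junc c a b ≅_) L
  ≅-junc-swapped {c = c} (b′ , a′ , b≅b′ , a≅a′ , b′a′∈) = lose (b′a′∈ c) (swap≅ c a≅a′ b≅b′)

  trees-complete : ∀ t n → Complete n t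
  trees-complete (leaf l) n ys _ l↭ _ _ with ↭-singleton-inv (↭-sym l↭)
  trees-complete (leaf l) (suc n) _ _ _ _ _ | refl = here (leaf≅ l)
  trees-complete (unary l u) _ [] _ lu↭ _ _ with () ← ↭-length lu↭
  trees-complete (unary l u) _ (x ∷ []) _ lu↭ _ _
    with () ← ℕ.≤-trans (labels-nonempty u) (ℕ.≤-reflexive (ℕ.suc-injective (↭-length lu↭)))
  trees-complete (unary l u) (suc n) (x ∷ xs@(_ ∷ _)) sorted lu↭ (l<u , u-inc) (s≤s xs≤n)
    with refl ← ↭-sorted-head l<u (AllPairs.head sorted) lu↭
    = Anyₚ.++⁺ˡ (Anyₚ.map⁺ (Any.map (unary≅ l) (trees-complete u n xs (AllPairs.tail sorted) (drop-∷ lu↭) u-inc xs≤n)))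
  trees-complete (junc c a b) _ [] _ ab↭ _ _
    with () ← ℕ.≤-trans (junc-labels-length c a b) (ℕ.≤-reflexive (↭-length ab↭))
  trees-complete (junc c a b) _ (x ∷ []) _ ab↭ _ _
    with s≤s () ← ℕ.≤-trans (junc-labels-length c a b) (ℕ.≤-reflexive (↭-length ab↭))
  trees-complete (junc c a b) (suc n) (x ∷ xs@(_ ∷ _)) sorted ab↭ (a-inc , b-inc) (s≤s xs≤n)
    with ∈-++⁻ (labels a) (∈-resp-↭ (↭-sym ab↭) (here refl))
  ... | inj₁ x∈a = Anyₚ.++⁺ʳ _ (≅-junc (junctionTrees-complete n sorted x∈a ab↭ xs≤n a-inc b-inc
                                           (trees-complete a n) (trees-complete b n)))
  ... | inj₂ x∈b = Anyₚ.++⁺ʳ _ (≅-junc-swapped (junctionTrees-complete n sorted x∈b (↭-trans (++-comm (labels b) (labels a)) ab↭)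
                                                  xs≤n b-inc a-inc (trees-complete b n) (trees-complete a n)))

  -- The number of trees on s labels, correct only when the fuel n is at least s.
  Y : ℕ → ℕ → ℕ
  Y zero    _             = 0
  Y (suc n) zero          = 0
  Y (suc n) (suc zero)    = 1
  Y (suc n) (suc (suc s)) = Y n (suc s) + m * subsetSum (suc s) (λ a b → Y n (suc a) * Y n b)

  length-trees : ∀ n xs → length (trees n xs) ≡ Y n (length xs)
  length-trees zero    _                = refl
  length-trees (suc n) []               = refl
  length-trees (suc n) (x ∷ [])         = refl
  length-trees (suc n) (x ∷ xs@(_ ∷ _)) = begin
    length (map (unary x) (trees n xs) ++ junctionTrees n x xs)
      ≡⟨ Listₚ.length-++ (map (unary x) (trees n xs)) ⟩
    length (map (unary x) (trees n xs)) + length (junctionTrees n x xs)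
      ≡⟨ cong₂ _+_ (trans (Listₚ.length-map (unary x) (trees n xs)) (length-trees n xs)) length-junctionTrees ⟩
    Y (suc n) (suc (length xs)) ∎
    where
    open ≡-Reasoning
    length-junctionTrees : length (junctionTrees n x xs) ≡ m * subsetSum (length xs) (λ a b → Y n (suc a) * Y n b)
    length-junctionTrees = begin
      length (junctionTrees n x xs)
        ≡⟨ length-concatMap _ (splits xs) ⟩
      ∑ (splits xs) (λ (A , B) → length (junctions (trees n (x ∷ A)) (trees n B)))
        ≡⟨ ∑-cong′ (splits xs) (λ (A , B) → begin
             length (junctions (trees n (x ∷ A)) (trees n B))
               ≡⟨ length-junctions (trees n (x ∷ A)) (trees n B) ⟩
             length (trees n (x ∷ A)) * (length (trees n B) * m)
               ≡⟨ cong₂ (λ p q → p * (q * m)) (length-trees n (x ∷ A)) (length-trees n B) ⟩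
             Y n (suc (length A)) * (Y n (length B) * m)
               ≡⟨ trans (sym (ℕ.*-assoc (Y n (suc (length A))) _ m)) (ℕ.*-comm _ m) ⟩
             m * (Y n (suc (length A)) * Y n (length B)) ∎) ⟩
      ∑ (splits xs) (λ (A , B) → m * (Y n (suc (length A)) * Y n (length B)))
        ≡⟨ ∑-*ˡ (splits xs) m (λ (A , B) → Y n (suc (length A)) * Y n (length B)) ⟩
      m * ∑ (splits xs) (λ (A , B) → Y n (suc (length A)) * Y n (length B))
        ≡⟨ cong (m *_) (∑-splits xs (λ a b → Y n (suc a) * Y n b)) ⟩
      m * subsetSum (length xs) (λ a b → Y n (suc a) * Y n b) ∎

  Y-zero : ∀ n → Y n 0 ≡ 0
  Y-zero zero    = refl
  Y-zero (suc n) = refl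

  -- For b = 0 the factor F (suc a) lies outside the range where F and G agree, but the product vanishes.
  products-cong : ∀ {s} (F G : ℕ → ℕ) → F 0 ≡ 0 → G 0 ≡ 0 → (∀ k → k ≤ suc s → F k ≡ G k) →
                  ∀ a b → a + b ≡ suc s → F (suc a) * F b ≡ G (suc a) * G b
  products-cong F G F0 G0 F≗G a zero    _  =
    trans (cong (F (suc a) *_) F0) (trans (ℕ.*-zeroʳ (F (suc a))) (sym (trans (cong (G (suc a) *_) G0) (ℕ.*-zeroʳ (G (suc a))))))
  products-cong F G F0 G0 F≗G a (suc b) ab≡ = cong₂ _*_
    (F≗G (suc a) (ℕ.≤-trans (s≤s (ℕ.m≤m+n a b)) (ℕ.≤-reflexive (trans (sym (ℕ.+-suc a b)) ab≡))))
    (F≗G (suc b) (ℕ.≤-trans (ℕ.m≤n+m (suc b) a) (ℕ.≤-reflexive ab≡)))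

  Y-fuel : ∀ s {n n′} → s ≤ n → s ≤ n′ → Y n s ≡ Y n′ s
  Y-fuel zero          {n}     {n′}     _          _           = trans (Y-zero n) (sym (Y-zero n′))
  Y-fuel (suc zero)    {suc n} {suc n′} _          _           = refl
  Y-fuel (suc (suc s)) {suc n} {suc n′} (s≤s s<n) (s≤s s<n′) = cong₂ _+_ (Y-fuel (suc s) s<n s<n′)
    (cong (m *_) (subsetSum-cong (suc s) (products-cong (Y n) (Y n′) (Y-zero n) (Y-zero n′)
      λ k k≤ → Y-fuel k (ℕ.≤-trans k≤ s<n) (ℕ.≤-trans k≤ s<n′))))

  y : ℕ → ℕ
  y s = Y s s

  y-suc : ∀ s → y (suc (suc s)) ≡ y (suc s) + m * subsetSum (suc s) (λ a b → y (suc a) * y b)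
  y-suc s = cong (λ z → y (suc s) + m * z) (subsetSum-cong (suc s)
    (products-cong (Y (suc s)) y (Y-zero (suc s)) refl λ k k≤ → Y-fuel k k≤ ℕ.≤-refl))

  y-counts-trees : ∀ s → 1 ≤ s → IsNumberOfTrees m s (y s)
  y-counts-trees s _ =
      trees s [1…s] , trans (length-trees s [1…s]) (cong (Y s) (length-1…s s))
    , All.tabulate (trees-sound s [1…s] (sorted-1…s s)) , trees-distinct s [1…s] (sorted-1…s s)
    , λ t (t↭ , t-inc) → trees-complete t s [1…s] (sorted-1…s s) t↭ t-inc (ℕ.≤-reflexive (length-1…s s))
    where [1…s] = map suc (upTo s)

open import Data.Integer using (+_)
import Data.Integer as ℤ
import Data.Integer.Properties as ℤ

ι : ℕ → ℚ
ι n = + n / 1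

private
  toℚᵘ-/ : ∀ a b → toℚᵘ (+ a / suc b) ℚᵘ.≃ mkℚᵘ (+ a) b
  toℚᵘ-/ a b = ℚ.toℚᵘ-fromℚᵘ (mkℚᵘ (+ a) b)

  /-≡ : ∀ a b c d → a * suc d ≡ c * suc b → + a / suc b ≡ + c / suc d
  /-≡ a b c d eq = ℚ.fromℚᵘ-cong {mkℚᵘ (+ a) b} {mkℚᵘ (+ c) d}
    (*≡* (trans (sym (ℤ.pos-* a (suc d))) (trans (cong +_ eq) (ℤ.pos-* c (suc b)))))

  /-*-/ : ∀ a b c d → (+ a / suc b) *ℚ (+ c / suc d) ≡ + (a * c) / (suc b * suc d)
  /-*-/ a b c d = ℚ.toℚᵘ-injective (ℚᵘ.≃-trans (ℚ.toℚᵘ-homo-* (+ a / suc b) (+ c / suc d))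
    (ℚᵘ.≃-trans (ℚᵘ.*-cong (toℚᵘ-/ a b) (toℚᵘ-/ c d))
    (ℚᵘ.≃-trans (ℚᵘ.≃-reflexive (cong (λ z → mkℚᵘ z (pred (suc b * suc d))) (sym (ℤ.pos-* a c))))
                (ℚᵘ.≃-sym (toℚᵘ-/ (a * c) (pred (suc b * suc d)))))))

  /-+-/ : ∀ a b c d → (+ a / suc b) +ℚ (+ c / suc d) ≡ + (a * suc d + c * suc b) / (suc b * suc d)
  /-+-/ a b c d = ℚ.toℚᵘ-injective (ℚᵘ.≃-trans (ℚ.toℚᵘ-homo-+ (+ a / suc b) (+ c / suc d))
    (ℚᵘ.≃-trans (ℚᵘ.+-cong (toℚᵘ-/ a b) (toℚᵘ-/ c d))
    (ℚᵘ.≃-trans (ℚᵘ.≃-reflexive (cong (λ z → mkℚᵘ z (pred (suc b * suc d)))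
                   (trans (cong₂ ℤ._+_ (sym (ℤ.pos-* a (suc d))) (sym (ℤ.pos-* c (suc b))))
                          (sym (ℤ.pos-+ (a * suc d) (c * suc b))))))
                (ℚᵘ.≃-sym (toℚᵘ-/ (a * suc d + c * suc b) (pred (suc b * suc d)))))))

ι-+ : ∀ a b → ι (a + b) ≡ ι a +ℚ ι b
ι-+ a b = sym (trans (/-+-/ a 0 b 0) (/-≡ (a * 1 + b * 1) 0 (a + b) 0
  (cong (_* 1) (cong₂ _+_ (ℕ.*-identityʳ a) (ℕ.*-identityʳ b)))))

ι-* : ∀ a b → ι (a * b) ≡ ι a *ℚ ι b
ι-* a b = sym (/-*-/ a 0 b 0)

ι-cancel : ∀ a d .{{_ : NonZero d}} → ι d *ℚ (+ a / d) ≡ ι a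
ι-cancel a (suc d) = trans (/-*-/ (suc d) 0 a d)
  (/-≡ (suc d * a) (d + 0) a 0
    (trans (ℕ.*-identityʳ _) (trans (ℕ.*-comm (suc d) a) (cong (a *_) (sym (ℕ.+-identityʳ (suc d)))))))

double-injective : ∀ p q → p +ℚ p ≡ q +ℚ q → p ≡ q
double-injective p q p+p≡q+q = begin
  p                          ≡⟨ solve 1 (λ p → p := con (+ 1 / 2) :* (p :+ p)) refl p ⟩
  (+ 1 / 2) *ℚ (p +ℚ p)      ≡⟨ cong ((+ 1 / 2) *ℚ_) p+p≡q+q ⟩
  (+ 1 / 2) *ℚ (q +ℚ q)      ≡⟨ solve 1 (λ q → con (+ 1 / 2) :* (q :+ q) := q) refl q ⟩
  q                          ∎
  where
  open ≡-Reasoning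
  open +-*-Solver

ℚ-semiring : CommutativeSemiring 0ℓ 0ℓ
ℚ-semiring = CommutativeRing.commutativeSemiring ℚ.+-*-commutativeRing

module ℚ∑ = ListSum ℚ-semiring

ι-∑ : ∀ {A : Set} (xs : List A) (f : A → ℕ) → ι (ℕ∑.∑ xs f) ≡ ℚ∑.∑ xs (ι ∘ f)
ι-∑ []       f = refl
ι-∑ (x ∷ xs) f = trans (ι-+ (f x) _) (cong (ι (f x) +ℚ_) (ι-∑ xs f))

C*!*!≡! : ∀ {n k} → k ≤ n → (n C k) * (k ! * (n ∸ k) !) ≡ n !
C*!*!≡! {n} {k} k≤n = trans (cong (_* (k ! * (n ∸ k) !)) (nCk≡n!/k![n-k]! k≤n))
                             (m/n*n≡m {{k !* (n ∸ k) !≢0}} (k![n∸k]!∣n! k≤n))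

+≡⇒≡∸ : ∀ n j k → T (j + k ≡ᵇ n) → k ≡ n ∸ j
+≡⇒≡∸ n j k j+k≡n = trans (sym (ℕ.m+n∸m≡n j k)) (cong (_∸ j) (ℕ.≡ᵇ⇒≡ (j + k) n j+k≡n))

module BellTwo (x : ℕ → ℕ) where

  open ℚ∑
  open +-*-Solver
  open ≡-Reasoning

  e : ℕ → ℚ
  e j = (+ x j / j !) {{j !≢0}}

  fac : ℕ → ℕ → ℚ
  fac i a = powℚ (e i) a *ℚ (+ 1 / a !) {{a !≢0}}

  selectSum : ℕ → ℕ → (ℕ → ℕ → Bool) → ℚ
  selectSum i l P = ∑ (boundedSeqs l 2) λ α → when (P (sumℕ α) (weighted i α)) (termProd x i α)

  selectSum-cong : ∀ i l {P Q : ℕ → ℕ → Bool} → (∀ s w → P s w ≡ Q s w) → selectSum i l P ≡ selectSum i l Q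
  selectSum-cong i l P≗Q =
    ∑-cong′ (boundedSeqs l 2) λ α → cong (λ b → when b (termProd x i α)) (P≗Q (sumℕ α) (weighted i α))

  selectSum-false : ∀ i l → selectSum i l (λ _ _ → false) ≡ 0ℚ
  selectSum-false i l = ∑-0 (boundedSeqs l 2)

  selectSum-suc : ∀ i l P → selectSum i (suc l) P ≡
                  selectSum (suc i) l P +ℚ (e i *ℚ selectSum (suc i) l (λ s w → P (suc s) (i + w))
                                          +ℚ fac i 2 *ℚ selectSum (suc i) l (λ s w → P (2 + s) (i + i + w)))
  selectSum-suc i l P = begin
    selectSum i (suc l) P
      ≡⟨ ∑-concatMap (λ a → map (a ∷_) (boundedSeqs l 2)) (upTo 3) _ ⟩
    part 0 +ℚ (part 1 +ℚ (part 2 +ℚ 0ℚ))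
      ≡⟨ cong (λ z → part 0 +ℚ (part 1 +ℚ z)) (ℚ.+-identityʳ (part 2)) ⟩
    part 0 +ℚ (part 1 +ℚ part 2)
      ≡⟨ cong₂ _+ℚ_ part0 (cong₂ _+ℚ_ part1 part2) ⟩
    selectSum (suc i) l P +ℚ (e i *ℚ selectSum (suc i) l (λ s w → P (suc s) (i + w))
                              +ℚ fac i 2 *ℚ selectSum (suc i) l (λ s w → P (2 + s) (i + i + w))) ∎
    where
    part : ℕ → ℚ
    part a = ∑ (map (a ∷_) (boundedSeqs l 2)) λ α → when (P (sumℕ α) (weighted i α)) (termProd x i α)

    part≡ : ∀ a → part a ≡ fac i a *ℚ selectSum (suc i) l (λ s w → P (a + s) (i * a + w))
    part≡ a = trans (∑-map (a ∷_) (boundedSeqs l 2) _)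
      (trans (∑-cong′ (boundedSeqs l 2) λ α → sym (*-when _ (fac i a) _)) (∑-*ˡ (boundedSeqs l 2) (fac i a) _))

    part0 : part 0 ≡ selectSum (suc i) l P
    part0 = trans (part≡ 0) (trans (ℚ.*-identityˡ _)
      (selectSum-cong (suc i) l λ s w → cong (P s) (cong (_+ w) (ℕ.*-zeroʳ i))))

    part1 : part 1 ≡ e i *ℚ selectSum (suc i) l (λ s w → P (suc s) (i + w))
    part1 = trans (part≡ 1) (cong₂ _*ℚ_ (trans (ℚ.*-identityʳ (e i *ℚ 1ℚ)) (ℚ.*-identityʳ (e i)))
      (selectSum-cong (suc i) l λ s w → cong (P (suc s)) (cong (_+ w) (ℕ.*-identityʳ i))))

    part2 : part 2 ≡ fac i 2 *ℚ selectSum (suc i) l (λ s w → P (2 + s) (i + i + w))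
    part2 = trans (part≡ 2) (cong (fac i 2 *ℚ_)
      (selectSum-cong (suc i) l λ s w → cong (P (2 + s)) (cong (_+ w) (trans (ℕ.*-comm i 2) (cong (λ z → i + z) (ℕ.+-identityʳ i))))))

  partSum : ℕ → ℕ → ℕ → (ℕ → Bool) → ℚ
  partSum k i l p = selectSum i l (λ s w → (s ≡ᵇ k) ∧ p w)

  partSum-0 : ∀ i l p → partSum 0 i l p ≡ when (p 0) 1ℚ
  partSum-0 i zero    p = ℚ.+-identityʳ _
  partSum-0 i (suc l) p = begin
    partSum 0 i (suc l) p
      ≡⟨ selectSum-suc i l (λ s w → (s ≡ᵇ 0) ∧ p w) ⟩
    partSum 0 (suc i) l p +ℚ (e i *ℚ selectSum (suc i) l (λ _ _ → false) +ℚ fac i 2 *ℚ selectSum (suc i) l (λ _ _ → false))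
      ≡⟨ cong₂ (λ u v → u +ℚ (e i *ℚ v +ℚ fac i 2 *ℚ v)) (partSum-0 (suc i) l p) (selectSum-false (suc i) l) ⟩
    when (p 0) 1ℚ +ℚ (e i *ℚ 0ℚ +ℚ fac i 2 *ℚ 0ℚ)
      ≡⟨ solve 3 (λ w a b → w :+ (a :* con 0ℚ :+ b :* con 0ℚ) := w) refl (when (p 0) 1ℚ) (e i) (fac i 2) ⟩
    when (p 0) 1ℚ ∎

  partSum-1 : ∀ i l p → partSum 1 i l p ≡ ∑ (range i l) (λ j → when (p j) (e j))
  partSum-1 i zero    p = ℚ.+-identityʳ 0ℚ
  partSum-1 i (suc l) p = begin
    partSum 1 i (suc l) p
      ≡⟨ selectSum-suc i l (λ s w → (s ≡ᵇ 1) ∧ p w) ⟩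
    partSum 1 (suc i) l p +ℚ (e i *ℚ partSum 0 (suc i) l (λ w → p (i + w)) +ℚ fac i 2 *ℚ selectSum (suc i) l (λ _ _ → false))
      ≡⟨ cong₂ (λ u v → u +ℚ (e i *ℚ v +ℚ fac i 2 *ℚ selectSum (suc i) l (λ _ _ → false)))
               (partSum-1 (suc i) l p) (partSum-0 (suc i) l (λ w → p (i + w))) ⟩
    S +ℚ (e i *ℚ when (p (i + 0)) 1ℚ +ℚ fac i 2 *ℚ selectSum (suc i) l (λ _ _ → false))
      ≡⟨ cong₂ (λ u v → S +ℚ (u +ℚ fac i 2 *ℚ v)) head (selectSum-false (suc i) l) ⟩
    S +ℚ (when (p i) (e i) +ℚ fac i 2 *ℚ 0ℚ)
      ≡⟨ solve 3 (λ s w b → s :+ (w :+ b :* con 0ℚ) := w :+ s) refl S (when (p i) (e i)) (fac i 2) ⟩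
    when (p i) (e i) +ℚ S ∎
    where
    S = ∑ (range (suc i) l) (λ j → when (p j) (e j))
    head : e i *ℚ when (p (i + 0)) 1ℚ ≡ when (p i) (e i)
    head = trans (*-when (p (i + 0)) (e i) 1ℚ)
                 (cong₂ when (cong p (ℕ.+-identityʳ i)) (ℚ.*-identityʳ (e i)))

  partSum-2 : ∀ i l p → partSum 2 i l p ≡ ∑ (range i l) (λ j → when (p (j + j)) (fac j 2))
                                          +ℚ ∑< (range i l) (λ j k → when (p (j + k)) (e j *ℚ e k))
  partSum-2 i zero    p = refl
  partSum-2 i (suc l) p = begin
    partSum 2 i (suc l) p
      ≡⟨ selectSum-suc i l (λ s w → (s ≡ᵇ 2) ∧ p w) ⟩
    partSum 2 (suc i) l p +ℚ (e i *ℚ partSum 1 (suc i) l (λ w → p (i + w)) +ℚ fac i 2 *ℚ partSum 0 (suc i) l (λ w → p (i + i + w)))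
      ≡⟨ cong₂ _+ℚ_ (partSum-2 (suc i) l p) (cong₂ (λ u v → e i *ℚ u +ℚ fac i 2 *ℚ v)
           (partSum-1 (suc i) l (λ w → p (i + w))) (partSum-0 (suc i) l (λ w → p (i + i + w)))) ⟩
    (D +ℚ Q) +ℚ (e i *ℚ ∑ (range (suc i) l) (λ k → when (p (i + k)) (e k)) +ℚ fac i 2 *ℚ when (p (i + i + 0)) 1ℚ)
      ≡⟨ cong (λ z → (D +ℚ Q) +ℚ z) (cong₂ _+ℚ_ row diagonal) ⟩
    (D +ℚ Q) +ℚ (R +ℚ when (p (i + i)) (fac i 2))
      ≡⟨ solve 4 (λ d q r w → (d :+ q) :+ (r :+ w) := (w :+ d) :+ (r :+ q)) refl D Q R (when (p (i + i)) (fac i 2)) ⟩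
    (when (p (i + i)) (fac i 2) +ℚ D) +ℚ (R +ℚ Q) ∎
    where
    D = ∑ (range (suc i) l) (λ j → when (p (j + j)) (fac j 2))
    Q = ∑< (range (suc i) l) (λ j k → when (p (j + k)) (e j *ℚ e k))
    R = ∑ (range (suc i) l) (λ k → when (p (i + k)) (e i *ℚ e k))
    row : e i *ℚ ∑ (range (suc i) l) (λ k → when (p (i + k)) (e k)) ≡ R
    row = trans (sym (∑-*ˡ (range (suc i) l) (e i) _)) (∑-cong′ (range (suc i) l) λ k → *-when (p (i + k)) (e i) (e k))
    diagonal : fac i 2 *ℚ when (p (i + i + 0)) 1ℚ ≡ when (p (i + i)) (fac i 2)
    diagonal = trans (*-when (p (i + i + 0)) (fac i 2) 1ℚ)
                     (cong₂ when (cong p (ℕ.+-identityʳ (i + i))) (ℚ.*-identityʳ (fac i 2)))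

  bell≡partSum : ∀ n → bell n 2 x ≡ ι (n !) *ℚ partSum 2 1 n (_≡ᵇ n)
  bell≡partSum n = begin
    bell n 2 x
      ≡⟨ ∑-as-foldr (boundedSeqs n 2) (λ α → when ((sumℕ α ≡ᵇ 2) ∧ (weighted 1 α ≡ᵇ n)) (ι (n !) *ℚ termProd x 1 α)) ⟩
    ∑ (boundedSeqs n 2) (λ α → when ((sumℕ α ≡ᵇ 2) ∧ (weighted 1 α ≡ᵇ n)) (ι (n !) *ℚ termProd x 1 α))
      ≡⟨ ∑-cong′ (boundedSeqs n 2) (λ α → sym (*-when _ (ι (n !)) (termProd x 1 α))) ⟩
    ∑ (boundedSeqs n 2) (λ α → ι (n !) *ℚ when ((sumℕ α ≡ᵇ 2) ∧ (weighted 1 α ≡ᵇ n)) (termProd x 1 α))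
      ≡⟨ ∑-*ˡ (boundedSeqs n 2) (ι (n !)) _ ⟩
    ι (n !) *ℚ partSum 2 1 n (_≡ᵇ n) ∎

  fac-2 : ∀ j → fac j 2 +ℚ fac j 2 ≡ e j *ℚ e j
  fac-2 j = solve 1 (λ a → (a :* (a :* con 1ℚ)) :* con (+ 1 / 2) :+ (a :* (a :* con 1ℚ)) :* con (+ 1 / 2) := a :* a) refl (e j)

  partSum-2-double : ∀ i l p → partSum 2 i l p +ℚ partSum 2 i l p ≡
                     ∑ (range i l) (λ j → ∑ (range i l) (λ k → when (p (j + k)) (e j *ℚ e k)))
  partSum-2-double i l p = begin
    partSum 2 i l p +ℚ partSum 2 i l p
      ≡⟨ cong (λ z → z +ℚ z) (partSum-2 i l p) ⟩
    (D +ℚ Q) +ℚ (D +ℚ Q)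
      ≡⟨ solve 2 (λ d q → (d :+ q) :+ (d :+ q) := (q :+ q) :+ (d :+ d)) refl D Q ⟩
    (Q +ℚ Q) +ℚ (D +ℚ D)
      ≡⟨ cong ((Q +ℚ Q) +ℚ_) (trans (sym (∑-+ (range i l) _ _)) (∑-cong′ (range i l) λ j →
           trans (when-+ (p (j + j)) (fac j 2) (fac j 2)) (cong (when (p (j + j))) (fac-2 j)))) ⟩
    (Q +ℚ Q) +ℚ ∑ (range i l) (λ j → when (p (j + j)) (e j *ℚ e j))
      ≡⟨ sym (∑∑-symmetric (range i l) (λ j k → when (p (j + k)) (e j *ℚ e k))
               (λ j k → cong₂ when (cong p (ℕ.+-comm j k)) (ℚ.*-comm (e j) (e k)))) ⟩
    ∑ (range i l) (λ j → ∑ (range i l) (λ k → when (p (j + k)) (e j *ℚ e k))) ∎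
    where
    D = ∑ (range i l) (λ j → when (p (j + j)) (fac j 2))
    Q = ∑< (range i l) (λ j k → when (p (j + k)) (e j *ℚ e k))

  ι-binomial-term : ∀ {n j} → j ≤ n → ι (n !) *ℚ (e j *ℚ e (n ∸ j)) ≡ ι ((n C j) * (x j * x (n ∸ j)))
  ι-binomial-term {n} {j} j≤n = sym (begin
    ι ((n C j) * (x j * x (n ∸ j)))
      ≡⟨ trans (ι-* (n C j) _) (cong (ι (n C j) *ℚ_) (ι-* (x j) (x (n ∸ j)))) ⟩
    ι (n C j) *ℚ (ι (x j) *ℚ ι (x (n ∸ j)))
      ≡⟨ cong (ι (n C j) *ℚ_) (cong₂ _*ℚ_ (sym (ι-cancel (x j) (j !) {{j !≢0}})) (sym (ι-cancel (x (n ∸ j)) ((n ∸ j) !) {{(n ∸ j) !≢0}}))) ⟩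
    ι (n C j) *ℚ ((ι (j !) *ℚ e j) *ℚ (ι ((n ∸ j) !) *ℚ e (n ∸ j)))
      ≡⟨ solve 5 (λ c a a′ u v → c :* ((a :* u) :* (a′ :* v)) := (c :* (a :* a′)) :* (u :* v)) refl
           (ι (n C j)) (ι (j !)) (ι ((n ∸ j) !)) (e j) (e (n ∸ j)) ⟩
    (ι (n C j) *ℚ (ι (j !) *ℚ ι ((n ∸ j) !))) *ℚ (e j *ℚ e (n ∸ j))
      ≡⟨ cong (_*ℚ (e j *ℚ e (n ∸ j))) (sym (trans (ι-* (n C j) _) (cong (ι (n C j) *ℚ_) (ι-* (j !) ((n ∸ j) !))))) ⟩
    ι ((n C j) * (j ! * (n ∸ j) !)) *ℚ (e j *ℚ e (n ∸ j))
      ≡⟨ cong (λ z → ι z *ℚ (e j *ℚ e (n ∸ j))) (C*!*!≡! j≤n) ⟩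
    ι (n !) *ℚ (e j *ℚ e (n ∸ j)) ∎)

  module _ (x0≡0 : x 0 ≡ 0) where

    e0≡0 : e 0 ≡ 0ℚ
    e0≡0 = cong (λ z → + z / 1) x0≡0

    antidiagonal : ∀ n {j} → j ∈ range 1 n →
                   ∑ (range 1 n) (λ k → when (j + k ≡ᵇ n) (e j *ℚ e k)) ≡ e j *ℚ e (n ∸ j)
    antidiagonal n {j} j∈ with ℕ.m≤n⇒m<n∨m≡n (ℕ.≤-pred (proj₂ (∈-range⁻ j∈)))
    ... | inj₁ j<n = ∑-range-when-unique 1 n (n ∸ j) (λ k → j + k ≡ᵇ n) (λ k → e j *ℚ e k) (+≡⇒≡∸ n j)
          (ℕ.≡⇒≡ᵇ (j + (n ∸ j)) n (ℕ.m+[n∸m]≡n (ℕ.<⇒≤ j<n))) (ℕ.m<n⇒0<n∸m j<n) (s≤s (ℕ.m∸n≤m n j))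
    ... | inj₂ refl = begin
      ∑ (range 1 j) (λ k → when (j + k ≡ᵇ j) (e j *ℚ e k))
        ≡⟨ ∑-range-when-below 1 j 0 (λ k → j + k ≡ᵇ j) (λ k → e j *ℚ e k)
             (λ k j+k≡j → trans (+≡⇒≡∸ j j k j+k≡j) (ℕ.n∸n≡0 j)) (s≤s z≤n) ⟩
      0ℚ
        ≡⟨ sym (trans (cong (λ k → e j *ℚ e k) (ℕ.n∸n≡0 j)) (trans (cong (e j *ℚ_) e0≡0) (ℚ.*-zeroʳ (e j)))) ⟩
      e j *ℚ e (j ∸ j) ∎

    bell-double : ∀ n → bell n 2 x +ℚ bell n 2 x ≡ ι (binomialSum n (λ a b → x a * x b))
    bell-double n = begin
      bell n 2 x +ℚ bell n 2 x
        ≡⟨ cong (λ z → z +ℚ z) (bell≡partSum n) ⟩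
      ι (n !) *ℚ P +ℚ ι (n !) *ℚ P
        ≡⟨ sym (ℚ.*-distribˡ-+ (ι (n !)) P P) ⟩
      ι (n !) *ℚ (P +ℚ P)
        ≡⟨ cong (ι (n !) *ℚ_) (trans (partSum-2-double 1 n (_≡ᵇ n)) (∑-cong (range 1 n) (antidiagonal n))) ⟩
      ι (n !) *ℚ ∑ (range 1 n) (λ j → e j *ℚ e (n ∸ j))
        ≡⟨ sym (∑-*ˡ (range 1 n) (ι (n !)) _) ⟩
      ∑ (range 1 n) (λ j → ι (n !) *ℚ (e j *ℚ e (n ∸ j)))
        ≡⟨ ∑-cong (range 1 n) (λ j∈ → ι-binomial-term (ℕ.≤-pred (proj₂ (∈-range⁻ j∈)))) ⟩
      ∑ (range 1 n) (λ j → ι ((n C j) * (x j * x (n ∸ j))))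
        ≡⟨ sym (ι-∑ (range 1 n) _) ⟩
      ι (ℕ∑.∑ (range 1 n) (λ j → (n C j) * (x j * x (n ∸ j))))
        ≡⟨ cong ι (sym leading-zero) ⟩
      ι (binomialSum n (λ a b → x a * x b)) ∎
      where
      P = partSum 2 1 n (_≡ᵇ n)
      S = ℕ∑.∑ (range 1 n) (λ j → (n C j) * (x j * x (n ∸ j)))
      leading-zero : binomialSum n (λ a b → x a * x b) ≡ S
      leading-zero = cong (_+ S) (trans (cong (λ z → (n C 0) * (z * x n)) x0≡0) (ℕ.*-zeroʳ (n C 0)))

bell-2-as-subsetSum : ∀ (x : ℕ → ℕ) → x 0 ≡ 0 → ∀ s → bell (suc s) 2 x ≡ ι (subsetSum s (λ a b → x (suc a) * x b))
bell-2-as-subsetSum x x0≡0 s = double-injective _ _ (begin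
  bell (suc s) 2 x +ℚ bell (suc s) 2 x         ≡⟨ BellTwo.bell-double x x0≡0 (suc s) ⟩
  ι (binomialSum (suc s) (λ a b → x a * x b))  ≡⟨ cong ι (sym (subsetSum-binomial (suc s) (λ a b → x a * x b))) ⟩
  ι (subsetSum (suc s) (λ a b → x a * x b))    ≡⟨ cong ι (subsetSum-suc-symmetric s (λ a b → x a * x b) (λ a b → ℕ.*-comm (x a) (x b))) ⟩
  ι (J + J)                                    ≡⟨ ι-+ J J ⟩
  ι J +ℚ ι J                                   ∎)
  where
  open ≡-Reasoning
  J = subsetSum s (λ a b → x (suc a) * x b)

mainTheorem6 : (m : ℕ) → 1 ≤ m →
    Σ (ℕ → ℕ) λ y →
      (∀ s → 1 ≤ s → IsNumberOfTrees m s (y s))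
      × y 1 ≡ 1
      × (∀ s → 1 ≤ s →  -- i.e. for every s' = suc s > 1
           (+ y (suc s) / 1) ≡ (+ y s / 1) +ℚ ((+ m / 1) *ℚ bell (suc s) 2 y))
mainTheorem6 m _ = y , y-counts-trees , refl , recurrence
  where
  open Enumeration m
  recurrence : ∀ s → 1 ≤ s → ι (y (suc s)) ≡ ι (y s) +ℚ ι m *ℚ bell (suc s) 2 y
  recurrence (suc s) _ = begin
    ι (y (suc (suc s)))                            ≡⟨ cong ι (y-suc s) ⟩
    ι (y (suc s) + m * J)                          ≡⟨ trans (ι-+ (y (suc s)) (m * J)) (cong (ι (y (suc s)) +ℚ_) (ι-* m J)) ⟩
    ι (y (suc s)) +ℚ ι m *ℚ ι J                    ≡⟨ cong (λ z → ι (y (suc s)) +ℚ ι m *ℚ z) (sym (bell-2-as-subsetSum y refl (suc s))) ⟩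
    ι (y (suc s)) +ℚ ι m *ℚ bell (suc (suc s)) 2 y ∎
    where
    open ≡-Reasoning
    J = subsetSum (suc s) (λ a b → y (suc a) * y b)
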